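{- Let $\gamma=\frac{2+\log_5 2}{3}=0.8102\dots$. There is an absolute constant $c>0$ such that for every positive integer $N$ there exists a set $A\subseteq[N]$ such that no non-zero difference $a-a'$ with $a,a'\in A$ lies in the set $\{x^2+5x^3: x\in\mathbb{Z}\}$, and $|A|\geq cN^{\gamma}$.
   Context: $[N]=\{1,2,\dots,N\}$. -}

module Defs where

open import Data.Nat using (ℕ; _≤_; _*_; _^_)
open import Data.Integer as ℤ using (ℤ; +_)

sqPlus5Cube : ℤ → ℤ
sqPlus5Cube x = x ℤ.* x ℤ.+ (+ 5) ℤ.* (x ℤ.* x ℤ.* x)

-- AtLeastGammaPower k n N  expresses exactly the real inequality
--     n ≥ (1/k) · N^γ,   γ = (2 + log₅ 2)/3,   (N ≥ 1)
-- Cubing: (k n)³ / N² ≥ N^{log₅ 2} = 2^{log₅ N}, i.e. log₅ N ≤ log₂ ((k n)³/N²).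
-- For reals x ≥ 0 and y:  x ≤ y  iff every rational r = p/q ≥ 0 with r ≤ x satisfies r ≤ y.
-- Here p/q ≤ log₅ N  iff  5^p ≤ N^q, and p/q ≤ log₂ ((k n)³/N²)  iff  2^p · N^{2q} ≤ (k n)^{3q}.
AtLeastGammaPower : ℕ → ℕ → ℕ → Set
AtLeastGammaPower k n N =
  ∀ p q → 1 ≤ q → 5 ^ p ≤ N ^ q → 2 ^ p * N ^ (2 * q) ≤ (k * n) ^ (3 * q)

-- Write i < 50^M in the mixed radix 5, 2, 5, 2, … and replace each digit pair (l < 5, b < 2) by
-- the base-5 digit pair (2b, l), keeping the top part i / 10^M < 5^M.  If two such numbers differ
-- by x² + c x³ with 5 ∣ c, the lowest digits give 2(b − b′) ≡ x² mod 5; as ±2 are non-residues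
-- mod 5, b = b′ and x = 5q, then reducing mod 25 gives l = l′, and the quotients by 25 differ by
-- q² + 5c q³.  Each step multiplies the cubic coefficient by 5, so after M steps the top parts
-- differ by a value of x² + c x³ with c = 5^(M+1), which is 0 or of absolute value at least c − 1.
-- This gives 50^M numbers below 125^M, and log 50 / log 125 = γ.
module Submission where

open import Defs
open import Data.Nat using (ℕ; _≤_)
open import Data.Integer as ℤ using (ℤ; +_)
open import Data.List using (List; length)
open import Data.List.Relation.Unary.All using (All)
open import Data.List.Relation.Unary.Unique.Propositional using (Unique)
open import Data.List.Membership.Propositional using (_∈_)
open import Data.Product using (Σ; _×_)
open import Relation.Binary.PropositionalEquality using (_≢_)

open import Data.Integer using (0ℤ; ∣_∣)
open import Data.Integer.DivMod using (_%ℕ_; _/ℕ_; a≡a%ℕn+[a/ℕn]*n; n%ℕd<d)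
open import Data.Integer.Divisibility.Signed
  using (_∣_; _∣?_; divides; quotient; ∣⇒∣ᵤ; ∣-refl; ∣m⇒∣m*n; ∣m+n∣n⇒∣m; ∣m∣n⇒∣m+n)
import Data.Integer.Properties as ℤₚ
open import Data.Integer.Tactic.RingSolver using (solve-∀; solve)
open import Data.List using ([]; _∷_; applyUpTo)
open import Data.List.Properties using (length-applyUpTo)
import Data.List.Relation.Unary.All as All
import Data.List.Relation.Unary.All.Properties as All
open import Data.List.Membership.Propositional.Properties using (∈-applyUpTo⁻)
import Data.List.Relation.Unary.Unique.Propositional.Properties as Unique
open import Data.Nat as ℕ using (zero; suc; _+_; _*_; _<_; _^_; _%_; _/_; _⊔_; _≟_; _≤?_; s≤s; z≤n)
open import Data.Nat.DivMod using (m≡m%n+[m/n]*n; m%n<n; m<n*o⇒m/o<n; m/n/o≡m/[n*o])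
open import Data.Nat.Divisibility using (∣⇒≤)
import Data.Nat.Properties as ℕₚ
open import Data.Nat.Properties using (allUpTo?)
open import Data.Nat.Tactic.RingSolver using () renaming (solve-∀ to ℕ-solve-∀)
open import Algebra.Properties.CommutativeSemigroup ℕₚ.*-commutativeSemigroup
  using (interchange; x∙yz≈y∙xz)
open import Data.Product using (_,_; ∃; proj₁; proj₂; map₂)
open import Function using (_∘_)
open import Relation.Binary.PropositionalEquality
  using (_≡_; refl; sym; trans; cong; cong₂; subst; module ≡-Reasoning)
open import Relation.Nullary using (yes; no; contradiction)
open import Relation.Nullary.Decidable using (from-yes; _→-dec_; _×-dec_)

sqPlusCube : ℤ → ℤ → ℤ
sqPlusCube c x = x ℤ.* x ℤ.+ c ℤ.* (x ℤ.* x ℤ.* x)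

sqPlusCube-0 : ∀ c → sqPlusCube c 0ℤ ≡ 0ℤ
sqPlusCube-0 c = trans (ℤₚ.+-identityˡ _) (ℤₚ.*-zeroʳ c)

sqPlusCube[q*5]≡5*5*sqPlusCube[5c] : ∀ c q →
  sqPlusCube c (q ℤ.* + 5) ≡ + 5 ℤ.* (+ 5 ℤ.* sqPlusCube (+ 5 ℤ.* c) q)
sqPlusCube[q*5]≡5*5*sqPlusCube[5c] = expand
  where
  -- The ring solver does not unfold sqPlusCube, so the identity is stated on the polynomial itself.
  expand : ∀ c q →
    q ℤ.* + 5 ℤ.* (q ℤ.* + 5) ℤ.+ c ℤ.* (q ℤ.* + 5 ℤ.* (q ℤ.* + 5) ℤ.* (q ℤ.* + 5)) ≡
    + 5 ℤ.* (+ 5 ℤ.* (q ℤ.* q ℤ.+ + 5 ℤ.* c ℤ.* (q ℤ.* q ℤ.* q)))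
  expand = solve-∀

∣c∣≤1+∣sqPlusCube∣ : ∀ c x .{{_ : ℤ.NonZero x}} → ∣ c ∣ ≤ suc (∣ sqPlusCube c x ∣)
∣c∣≤1+∣sqPlusCube∣ c x = begin
  ∣ c ∣                                     ≤⟨ ℕₚ.m≤m*n (∣ c ∣) (∣ x ∣) ⟩
  ∣ c ∣ * ∣ x ∣                             ≡⟨ ℤₚ.abs-* c x ⟨
  ∣ c ℤ.* x ∣                               ≡⟨ cong ∣_∣ cx≡[1+cx]-1 ⟩
  ∣ (ℤ.1ℤ ℤ.+ c ℤ.* x) ℤ.- ℤ.1ℤ ∣            ≤⟨ ℤₚ.∣i-j∣≤∣i∣+∣j∣ (ℤ.1ℤ ℤ.+ c ℤ.* x) ℤ.1ℤ ⟩
  ∣ ℤ.1ℤ ℤ.+ c ℤ.* x ∣ + 1                  ≤⟨ ℕₚ.+-monoˡ-≤ 1 (ℕₚ.m≤n*m _ (∣ x ∣ * ∣ x ∣) {{x²≢0}}) ⟩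
  ∣ x ∣ * ∣ x ∣ * ∣ ℤ.1ℤ ℤ.+ c ℤ.* x ∣ + 1     ≡⟨ cong (_+ 1) ∣x²[1+cx]∣ ⟨
  ∣ x ℤ.* x ℤ.* (ℤ.1ℤ ℤ.+ c ℤ.* x) ∣ + 1       ≡⟨ cong (λ y → ∣ y ∣ + 1) x²[1+cx]≡sqPlusCube ⟩
  ∣ sqPlusCube c x ∣ + 1                    ≡⟨ ℕₚ.+-comm _ 1 ⟩
  suc (∣ sqPlusCube c x ∣)                  ∎
  where
  open ℕₚ.≤-Reasoning
  x²≢0 : ℕ.NonZero (∣ x ∣ * ∣ x ∣)
  x²≢0 = ℕₚ.m*n≢0 (∣ x ∣) (∣ x ∣)
  cx≡[1+cx]-1 : c ℤ.* x ≡ (ℤ.1ℤ ℤ.+ c ℤ.* x) ℤ.- ℤ.1ℤ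
  cx≡[1+cx]-1 = solve (c ∷ x ∷ [])
  ∣x²[1+cx]∣ : ∣ x ℤ.* x ℤ.* (ℤ.1ℤ ℤ.+ c ℤ.* x) ∣ ≡ ∣ x ∣ * ∣ x ∣ * ∣ ℤ.1ℤ ℤ.+ c ℤ.* x ∣
  ∣x²[1+cx]∣ = trans (ℤₚ.abs-* (x ℤ.* x) _) (cong (_* ∣ ℤ.1ℤ ℤ.+ c ℤ.* x ∣) (ℤₚ.abs-* x x))
  x²[1+cx]≡sqPlusCube : x ℤ.* x ℤ.* (ℤ.1ℤ ℤ.+ c ℤ.* x) ≡ x ℤ.* x ℤ.+ c ℤ.* (x ℤ.* x ℤ.* x)
  x²[1+cx]≡sqPlusCube = solve (c ∷ x ∷ [])

∣[+m]-[+n]∣<o : ∀ {m n o} → m < o → n < o → ∣ + m ℤ.- + n ∣ < o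
∣[+m]-[+n]∣<o {m} {n} m<o n<o = begin-strict
  ∣ + m ℤ.- + n ∣  ≡⟨ cong ∣_∣ (ℤₚ.[+m]-[+n]≡m⊖n m n) ⟩
  ∣ m ℤ.⊖ n ∣      ≤⟨ ℤₚ.∣m⊝n∣≤m⊔n m n ⟩
  m ⊔ n           <⟨ ℕₚ.⊔-lub m<o n<o ⟩
  _               ∎
  where open ℕₚ.≤-Reasoning

[+1+m]-[+1+n]≡[+m]-[+n] : ∀ m n → + suc m ℤ.- + suc n ≡ + m ℤ.- + n
[+1+m]-[+1+n]≡[+m]-[+n] m n = trans (ℤₚ.[+m]-[+n]≡m⊖n (suc m) (suc n))
  (trans (ℤₚ.[1+m]⊖[1+n]≡m⊖n m n) (sym (ℤₚ.[+m]-[+n]≡m⊖n m n)))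

sqPlusCube-avoids-small-differences : ∀ {c k t t′} → k < ∣ c ∣ → t < k → t′ < k → ∀ x →
  + t ℤ.- + t′ ≡ sqPlusCube c x → t ≡ t′
sqPlusCube-avoids-small-differences {c} {k} {t} {t′} k<∣c∣ t<k t′<k x eq with x ℤ.≟ 0ℤ
... | yes refl = ℤₚ.+-injective (ℤₚ.i-j≡0⇒i≡j _ _ (trans eq (sqPlusCube-0 c)))
... | no x≢0   = contradiction k<∣c∣ (ℕₚ.≤⇒≯ (begin
  ∣ c ∣                      ≤⟨ ∣c∣≤1+∣sqPlusCube∣ c x {{ℤ.≢-nonZero x≢0}} ⟩
  suc (∣ sqPlusCube c x ∣)   ≡⟨ cong (suc ∘ ∣_∣) eq ⟨
  suc (∣ + t ℤ.- + t′ ∣)     ≤⟨ ∣[+m]-[+n]∣<o t<k t′<k ⟩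
  k                          ∎))
  where open ℕₚ.≤-Reasoning

∣i∣<n∧n∣i⇒i≡0 : ∀ {n} i → ∣ i ∣ < n → + n ∣ i → i ≡ 0ℤ
∣i∣<n∧n∣i⇒i≡0 i ∣i∣<n n∣i with i ℤ.≟ 0ℤ
... | yes i≡0 = i≡0
... | no i≢0  = contradiction (∣⇒≤ {{ℤ.≢-nonZero i≢0}} (∣⇒∣ᵤ n∣i)) (ℕₚ.<⇒≱ ∣i∣<n)

digit-unique : ∀ n {l l′} → l < n → l′ < n → ∀ D W →
  (+ l ℤ.- + l′) ℤ.+ + n ℤ.* D ≡ + n ℤ.* W → l ≡ l′ × D ≡ W
digit-unique n {l} {l′} l<n l′<n D W eq =
  ℤₚ.+-injective (ℤₚ.i-j≡0⇒i≡j _ _ l-l′≡0) ,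
  ℤₚ.*-cancelˡ-≡ (+ n) D W (trans (sym (trans (cong (ℤ._+ + n ℤ.* D) l-l′≡0) (ℤₚ.+-identityˡ _))) eq)
  where
  instance _ = ℕ.>-nonZero (ℕₚ.≤-<-trans z≤n l<n)
  n∣l-l′ : + n ∣ + l ℤ.- + l′
  n∣l-l′ = ∣m+n∣n⇒∣m (subst (+ n ∣_) (sym eq) (∣m⇒∣m*n W ∣-refl)) (∣m⇒∣m*n D ∣-refl)
  l-l′≡0 : + l ℤ.- + l′ ≡ 0ℤ
  l-l′≡0 = ∣i∣<n∧n∣i⇒i≡0 _ (∣[+m]-[+n]∣<o l<n l′<n) n∣l-l′

±2-nonresidue-mod-5 : ∀ {b} → b < 2 → ∀ {b′} → b′ < 2 → ∀ {r} → r < 5 →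
  + 5 ∣ + 2 ℤ.* (+ b ℤ.- + b′) ℤ.- + r ℤ.* + r → b ≡ b′ × r ≡ 0
±2-nonresidue-mod-5 = from-yes (allUpTo? (λ b → allUpTo? (λ b′ → allUpTo? (λ r →
  (+ 5 ∣? + 2 ℤ.* (+ b ℤ.- + b′) ℤ.- + r ℤ.* + r) →-dec ((b ≟ b′) ×-dec (r ≟ 0))) 5) 2) 2)

5∣2[b-b′]-x²⇒b≡b′∧5∣x : ∀ {b b′} → b < 2 → b′ < 2 → ∀ x →
  + 5 ∣ + 2 ℤ.* (+ b ℤ.- + b′) ℤ.- x ℤ.* x → b ≡ b′ × + 5 ∣ x
5∣2[b-b′]-x²⇒b≡b′∧5∣x {b} {b′} b<2 b′<2 x 5∣2β-x² =
  map₂ 5∣x (±2-nonresidue-mod-5 b<2 b′<2 (n%ℕd<d x 5) 5∣2β-r²)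
  where
  r : ℕ
  r = x %ℕ 5
  q β : ℤ
  q = x /ℕ 5
  β = + b ℤ.- + b′
  x≡r+q*5 : x ≡ + r ℤ.+ q ℤ.* + 5
  x≡r+q*5 = a≡a%ℕn+[a/ℕn]*n x 5
  [d-x²]+5Q≡d-r² : ∀ d r q →
    (d ℤ.- (r ℤ.+ q ℤ.* + 5) ℤ.* (r ℤ.+ q ℤ.* + 5)) ℤ.+ + 5 ℤ.* (q ℤ.* (+ 2 ℤ.* r ℤ.+ q ℤ.* + 5)) ≡
    d ℤ.- r ℤ.* r
  [d-x²]+5Q≡d-r² = solve-∀
  5∣2β-r² : + 5 ∣ + 2 ℤ.* β ℤ.- + r ℤ.* + r
  5∣2β-r² = subst (+ 5 ∣_) ([d-x²]+5Q≡d-r² (+ 2 ℤ.* β) (+ r) q)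
    (∣m∣n⇒∣m+n (subst (λ y → + 5 ∣ + 2 ℤ.* β ℤ.- y ℤ.* y) x≡r+q*5 5∣2β-x²) (∣m⇒∣m*n _ ∣-refl))
  5∣x : r ≡ 0 → + 5 ∣ x
  5∣x r≡0 = divides q (trans x≡r+q*5 (trans (cong (λ r → + r ℤ.+ q ℤ.* + 5) r≡0) (ℤₚ.+-identityˡ _)))

sqPlusCube[5c]≡x²-mod-5 : ∀ c β Λ x → + 2 ℤ.* β ℤ.+ + 5 ℤ.* Λ ≡ sqPlusCube (+ 5 ℤ.* c) x →
  + 5 ∣ + 2 ℤ.* β ℤ.- x ℤ.* x
sqPlusCube[5c]≡x²-mod-5 c β Λ x eq = divides (c ℤ.* (x ℤ.* x ℤ.* x) ℤ.- Λ) (begin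
  + 2 ℤ.* β ℤ.- x ℤ.* x
    ≡⟨ solve (β ∷ Λ ∷ x ∷ []) ⟩
  (+ 2 ℤ.* β ℤ.+ + 5 ℤ.* Λ) ℤ.- + 5 ℤ.* Λ ℤ.- x ℤ.* x
    ≡⟨ cong (λ y → y ℤ.- + 5 ℤ.* Λ ℤ.- x ℤ.* x) eq ⟩
  (x ℤ.* x ℤ.+ + 5 ℤ.* c ℤ.* (x ℤ.* x ℤ.* x)) ℤ.- + 5 ℤ.* Λ ℤ.- x ℤ.* x
    ≡⟨ solve (c ∷ Λ ∷ x ∷ []) ⟩
  (c ℤ.* (x ℤ.* x ℤ.* x) ℤ.- Λ) ℤ.* + 5
    ∎)
  where open ≡-Reasoning

digit-step : ∀ c {b b′ l l′} → b < 2 → b′ < 2 → l < 5 → l′ < 5 → ∀ F F′ x →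
  + 2 ℤ.* (+ b ℤ.- + b′) ℤ.+ + 5 ℤ.* ((+ l ℤ.- + l′) ℤ.+ + 5 ℤ.* (F ℤ.- F′)) ≡ sqPlusCube (+ 5 ℤ.* c) x →
  b ≡ b′ × l ≡ l′ × ∃ λ q → F ℤ.- F′ ≡ sqPlusCube (+ 5 ℤ.* (+ 5 ℤ.* c)) q
digit-step c {b} {b′} {l} {l′} b<2 b′<2 l<5 l′<5 F F′ x eq =
  b≡b′ , map₂ (q ,_) (digit-unique 5 l<5 l′<5 (F ℤ.- F′) (sqPlusCube (+ 5 ℤ.* (+ 5 ℤ.* c)) q) Λ≡5P)
  where
  β Λ : ℤ
  β = + b ℤ.- + b′
  Λ = (+ l ℤ.- + l′) ℤ.+ + 5 ℤ.* (F ℤ.- F′)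
  b≡b′∧5∣x : b ≡ b′ × + 5 ∣ x
  b≡b′∧5∣x = 5∣2[b-b′]-x²⇒b≡b′∧5∣x b<2 b′<2 x (sqPlusCube[5c]≡x²-mod-5 c β Λ x eq)
  b≡b′ : b ≡ b′
  b≡b′ = proj₁ b≡b′∧5∣x
  q : ℤ
  q = quotient (proj₂ b≡b′∧5∣x)
  x≡q*5 : x ≡ q ℤ.* + 5
  x≡q*5 = _∣_.equality (proj₂ b≡b′∧5∣x)
  Λ≡5P : Λ ≡ + 5 ℤ.* sqPlusCube (+ 5 ℤ.* (+ 5 ℤ.* c)) q
  Λ≡5P = ℤₚ.*-cancelˡ-≡ (+ 5) _ _ (begin
    + 5 ℤ.* Λ                            ≡⟨ ℤₚ.+-identityˡ _ ⟨
    0ℤ ℤ.+ + 5 ℤ.* Λ                      ≡⟨ cong (λ β → + 2 ℤ.* β ℤ.+ + 5 ℤ.* Λ) (ℤₚ.i≡j⇒i-j≡0 (cong +_ b≡b′)) ⟨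
    + 2 ℤ.* β ℤ.+ + 5 ℤ.* Λ                ≡⟨ eq ⟩
    sqPlusCube (+ 5 ℤ.* c) x               ≡⟨ cong (sqPlusCube (+ 5 ℤ.* c)) x≡q*5 ⟩
    sqPlusCube (+ 5 ℤ.* c) (q ℤ.* + 5)     ≡⟨ sqPlusCube[q*5]≡5*5*sqPlusCube[5c] (+ 5 ℤ.* c) q ⟩
    + 5 ℤ.* (+ 5 ℤ.* sqPlusCube (+ 5 ℤ.* (+ 5 ℤ.* c)) q) ∎)
    where open ≡-Reasoning

digit₅ digit₂ rest : ℕ → ℕ
digit₅ i = i % 5
digit₂ i = (i / 5) % 2
rest   i = i / 10

i≡digit₅+[digit₂+rest*2]*5 : ∀ i → i ≡ digit₅ i + (digit₂ i + rest i * 2) * 5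
i≡digit₅+[digit₂+rest*2]*5 i = begin
  i
    ≡⟨ m≡m%n+[m/n]*n i 5 ⟩
  i % 5 + (i / 5) * 5
    ≡⟨ cong (λ y → i % 5 + y * 5) (m≡m%n+[m/n]*n (i / 5) 2) ⟩
  i % 5 + ((i / 5) % 2 + (i / 5 / 2) * 2) * 5
    ≡⟨ cong (λ y → i % 5 + ((i / 5) % 2 + y * 2) * 5) (m/n/o≡m/[n*o] i 5 2) ⟩
  i % 5 + ((i / 5) % 2 + (i / 10) * 2) * 5
    ∎
  where open ≡-Reasoning

digits-injective : ∀ {i j} → digit₅ i ≡ digit₅ j → digit₂ i ≡ digit₂ j → rest i ≡ rest j → i ≡ j
digits-injective {i} {j} d₅≡ d₂≡ rest≡ = begin
  i                                        ≡⟨ i≡digit₅+[digit₂+rest*2]*5 i ⟩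
  digit₅ i + (digit₂ i + rest i * 2) * 5   ≡⟨ cong₂ (λ l r → l + r * 5) d₅≡ (cong₂ (λ b h → b + h * 2) d₂≡ rest≡) ⟩
  digit₅ j + (digit₂ j + rest j * 2) * 5   ≡⟨ i≡digit₅+[digit₂+rest*2]*5 j ⟨
  j                                        ∎
  where open ≡-Reasoning

rest-< : ∀ m {T i} → i < 10 ^ suc m * T → rest i < 10 ^ m * T
rest-< m {T} {i} i< = m<n*o⇒m/o<n {i} {10 ^ m * T} {10}
  (subst (i <_) (trans (ℕₚ.*-assoc 10 (10 ^ m) T) (ℕₚ.*-comm 10 (10 ^ m * T))) i<)

embed : ℕ → ℕ → ℕ
embed zero    i = i
embed (suc m) i = 2 * digit₂ i + 5 * digit₅ i + 25 * embed m (rest i)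

embed-suc-difference : ∀ m i j → + embed (suc m) i ℤ.- + embed (suc m) j ≡
  + 2 ℤ.* (+ digit₂ i ℤ.- + digit₂ j) ℤ.+
  + 5 ℤ.* ((+ digit₅ i ℤ.- + digit₅ j) ℤ.+ + 5 ℤ.* (+ embed m (rest i) ℤ.- + embed m (rest j)))
embed-suc-difference m i j = trans (cong₂ ℤ._-_ (+embed-suc i) (+embed-suc j))
  (regroup (+ digit₂ i) (+ digit₅ i) (+ embed m (rest i)) (+ digit₂ j) (+ digit₅ j) (+ embed m (rest j)))
  where
  +embed-suc : ∀ i →
    + embed (suc m) i ≡ + 2 ℤ.* + digit₂ i ℤ.+ + 5 ℤ.* + digit₅ i ℤ.+ + 25 ℤ.* + embed m (rest i)
  +embed-suc i = trans (ℤₚ.pos-+ (2 * digit₂ i + 5 * digit₅ i) (25 * embed m (rest i)))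
    (cong₂ ℤ._+_ (trans (ℤₚ.pos-+ (2 * digit₂ i) (5 * digit₅ i))
                        (cong₂ ℤ._+_ (ℤₚ.pos-* 2 (digit₂ i)) (ℤₚ.pos-* 5 (digit₅ i))))
                 (ℤₚ.pos-* 25 (embed m (rest i))))
  regroup : ∀ b l F b′ l′ F′ →
    (+ 2 ℤ.* b ℤ.+ + 5 ℤ.* l ℤ.+ + 25 ℤ.* F) ℤ.- (+ 2 ℤ.* b′ ℤ.+ + 5 ℤ.* l′ ℤ.+ + 25 ℤ.* F′) ≡
    + 2 ℤ.* (b ℤ.- b′) ℤ.+ + 5 ℤ.* ((l ℤ.- l′) ℤ.+ + 5 ℤ.* (F ℤ.- F′))
  regroup = solve-∀

embed-separates : ∀ m {c T i j} → T < 5 ^ suc m * ∣ c ∣ → i < 10 ^ m * T → j < 10 ^ m * T → ∀ x →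
  + embed m i ℤ.- + embed m j ≡ sqPlusCube (+ 5 ℤ.* c) x → i ≡ j
embed-separates zero {c} {T} {i} {j} T< i< j< =
  sqPlusCube-avoids-small-differences {+ 5 ℤ.* c} (subst (T <_) (sym (ℤₚ.abs-* (+ 5) c)) T<)
    (subst (i <_) (ℕₚ.*-identityˡ T) i<) (subst (j <_) (ℕₚ.*-identityˡ T) j<)
embed-separates (suc m) {c} {T} {i} {j} T< i< j< x eq =
  let d₂≡ , d₅≡ , q , eq′ = digit-step c {digit₂ i} {digit₂ j} {digit₅ i} {digit₅ j}
                              (m%n<n (i / 5) 2) (m%n<n (j / 5) 2) (m%n<n i 5) (m%n<n j 5)
                              (+ embed m (rest i)) (+ embed m (rest j)) x
                              (trans (sym (embed-suc-difference m i j)) eq)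
  in digits-injective d₅≡ d₂≡ (embed-separates m {+ 5 ℤ.* c} T<′ (rest-< m i<) (rest-< m j<) q eq′)
  where
  T<′ : T < 5 ^ suc m * ∣ + 5 ℤ.* c ∣
  T<′ = subst (T <_) (trans (ℕₚ.*-assoc 5 (5 ^ suc m) ∣ c ∣)
                     (trans (x∙yz≈y∙xz 5 (5 ^ suc m) ∣ c ∣) (cong (5 ^ suc m *_) (sym (ℤₚ.abs-* (+ 5) c))))) T<

a<n∧F<B⇒a+n*F<n*B : ∀ {a n F B} → a < n → F < B → a + n * F < n * B
a<n∧F<B⇒a+n*F<n*B {a} {n} {F} {B} a<n F<B = begin-strict
  a + n * F   <⟨ ℕₚ.+-monoˡ-< (n * F) a<n ⟩
  n + n * F   ≡⟨ ℕₚ.*-suc n F ⟨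
  n * suc F   ≤⟨ ℕₚ.*-monoʳ-≤ n F<B ⟩
  n * B       ∎
  where open ℕₚ.≤-Reasoning

embed-< : ∀ m {T i} → i < 10 ^ m * T → embed m i < 25 ^ m * T
embed-< zero    i<T = i<T
embed-< (suc m) {T} {i} i< = subst (embed (suc m) i <_) (sym (ℕₚ.*-assoc 25 (25 ^ m) T))
  (a<n∧F<B⇒a+n*F<n*B low-digits<25 (embed-< m (rest-< m i<)))
  where
  low-digits<25 : 2 * digit₂ i + 5 * digit₅ i < 25
  low-digits<25 = s≤s (ℕₚ.≤-trans
    (ℕₚ.+-mono-≤ (ℕₚ.*-monoʳ-≤ 2 (ℕₚ.≤-pred (m%n<n (i / 5) 2))) (ℕₚ.*-monoʳ-≤ 5 (ℕₚ.≤-pred (m%n<n i 5))))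
    (ℕₚ.m≤m+n 22 2))

n<b^n : ∀ {b} → 1 < b → ∀ n → n < b ^ n
n<b^n     1<b zero    = s≤s z≤n
n<b^n {b} 1<b (suc n) = ℕₚ.≤-<-trans (n<b^n 1<b n) (ℕₚ.^-monoʳ-< b 1<b (ℕₚ.n<1+n n))

power-bracket-below : ∀ b g {N} → 0 < N → N < b ^ g → ∃ λ M → b ^ M ≤ N × N < b ^ suc M
power-bracket-below b zero        0<N N<1 = contradiction (ℕₚ.≤-pred N<1) (ℕₚ.<⇒≱ 0<N)
power-bracket-below b (suc g) {N} 0<N N<b^[1+g] with b ^ g ≤? N
... | yes b^g≤N = g , b^g≤N , N<b^[1+g]
... | no  b^g≰N = power-bracket-below b g 0<N (ℕₚ.≰⇒> b^g≰N)

power-bracket : ∀ {b N} → 1 < b → 0 < N → ∃ λ M → b ^ M ≤ N × N < b ^ suc M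
power-bracket {b} {N} 1<b 0<N = power-bracket-below b N 0<N (n<b^n 1<b N)

^-distribʳ-* : ∀ m n o → (m * n) ^ o ≡ m ^ o * n ^ o
^-distribʳ-* m n zero    = refl
^-distribʳ-* m n (suc o) = trans (cong (m * n *_) (^-distribʳ-* m n o)) (interchange m n (m ^ o) (n ^ o))

^-cancelʳ-≤ : ∀ {b m n} → 1 < b → b ^ m ≤ b ^ n → m ≤ n
^-cancelʳ-≤ {b} 1<b b^m≤b^n = ℕₚ.≮⇒≥ (λ n<m → ℕₚ.<⇒≱ (ℕₚ.^-monoʳ-< b 1<b n<m) b^m≤b^n)

50^M-atLeastGammaPower : ∀ M {N} → N ≤ 125 ^ suc M → AtLeastGammaPower 50 (50 ^ M) N
50^M-atLeastGammaPower M {N} N≤125^[1+M] p q _ 5^p≤N^q = begin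
  2 ^ p * N ^ (2 * q)
    ≤⟨ ℕₚ.*-mono-≤ (ℕₚ.^-monoʳ-≤ 2 p≤3K) (ℕₚ.^-monoˡ-≤ (2 * q) N≤125^[1+M]) ⟩
  2 ^ (3 * K) * (125 ^ suc M) ^ (2 * q)
    ≡⟨ cong (2 ^ (3 * K) *_) 125^[1+M]^[2q]≡25^[3K] ⟩
  2 ^ (3 * K) * 25 ^ (3 * K)
    ≡⟨ ^-distribʳ-* 2 25 (3 * K) ⟨
  50 ^ (3 * K)
    ≡⟨ cong (50 ^_) (x∙yz≈y∙xz 3 (suc M) q) ⟩
  50 ^ (suc M * (3 * q))
    ≡⟨ ℕₚ.^-*-assoc 50 (suc M) (3 * q) ⟨
  (50 * 50 ^ M) ^ (3 * q)
    ∎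
  where
  open ℕₚ.≤-Reasoning
  K : ℕ
  K = suc M * q
  p≤3K : p ≤ 3 * K
  p≤3K = ^-cancelʳ-≤ {5} (s≤s (s≤s z≤n)) (ℕₚ.≤-trans 5^p≤N^q (begin
    N ^ q               ≤⟨ ℕₚ.^-monoˡ-≤ q N≤125^[1+M] ⟩
    (125 ^ suc M) ^ q   ≡⟨ ℕₚ.^-*-assoc 125 (suc M) q ⟩
    125 ^ K             ≡⟨ ℕₚ.^-*-assoc 5 3 K ⟩
    5 ^ (3 * K)         ∎))
  125^[1+M]^[2q]≡25^[3K] : (125 ^ suc M) ^ (2 * q) ≡ 25 ^ (3 * K)
  125^[1+M]^[2q]≡25^[3K] = begin-equality
    (125 ^ suc M) ^ (2 * q)       ≡⟨ ℕₚ.^-*-assoc 125 (suc M) (2 * q) ⟩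
    125 ^ (suc M * (2 * q))       ≡⟨ ℕₚ.^-*-assoc 5 3 (suc M * (2 * q)) ⟩
    5 ^ (3 * (suc M * (2 * q)))   ≡⟨ cong (5 ^_) (exponents (suc M) q) ⟩
    5 ^ (2 * (3 * K))             ≡⟨ ℕₚ.^-*-assoc 5 2 (3 * K) ⟨
    25 ^ (3 * K)                  ∎
    where
    exponents : ∀ e q → 3 * (e * (2 * q)) ≡ 2 * (3 * (e * q))
    exponents = ℕ-solve-∀

DifferencesAvoid : (ℤ → ℤ) → List ℕ → Set
DifferencesAvoid f A = ∀ {a a′} → a ∈ A → a′ ∈ A → a ≢ a′ → (x : ℤ) → (+ a) ℤ.- (+ a′) ≢ f x

embedSet : ℕ → List ℕ
embedSet M = applyUpTo (suc ∘ embed M) (50 ^ M)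

embed-separates-sqPlus5Cube : ∀ M {i j} → i < 50 ^ M → j < 50 ^ M → ∀ x →
  + embed M i ℤ.- + embed M j ≡ sqPlus5Cube x → i ≡ j
embed-separates-sqPlus5Cube M {i} {j} i< j< =
  embed-separates M {+ 1} {5 ^ M} 5^M<5^[1+M]*1
    (subst (i <_) 50^M≡10^M*5^M i<) (subst (j <_) 50^M≡10^M*5^M j<)
  where
  50^M≡10^M*5^M : 50 ^ M ≡ 10 ^ M * 5 ^ M
  50^M≡10^M*5^M = ^-distribʳ-* 10 5 M
  5^M<5^[1+M]*1 : 5 ^ M < 5 ^ suc M * 1
  5^M<5^[1+M]*1 = subst (5 ^ M <_) (sym (ℕₚ.*-identityʳ (5 ^ suc M)))
    (ℕₚ.^-monoʳ-< 5 (s≤s (s≤s z≤n)) (ℕₚ.n<1+n M))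

embedSet-unique : ∀ M → Unique (embedSet M)
embedSet-unique M = Unique.applyUpTo⁺₁ (suc ∘ embed M) (50 ^ M) λ {i} {j} i<j j< e →
  ℕₚ.<-irrefl (embed-separates-sqPlus5Cube M (ℕₚ.<-trans i<j j<) j< 0ℤ
    (trans (ℤₚ.i≡j⇒i-j≡0 (cong +_ (ℕₚ.suc-injective e))) (sym (sqPlusCube-0 (+ 5))))) i<j

embedSet-bounds : ∀ M → All (λ a → 1 ≤ a × a ≤ 125 ^ M) (embedSet M)
embedSet-bounds M = All.applyUpTo⁺₁ (suc ∘ embed M) (50 ^ M) λ {i} i< →
  s≤s z≤n ,
  subst (embed M i <_) (sym (^-distribʳ-* 25 5 M)) (embed-< M (subst (i <_) (^-distribʳ-* 10 5 M) i<))

embedSet-differencesAvoid : ∀ M → DifferencesAvoid sqPlus5Cube (embedSet M)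
embedSet-differencesAvoid M a∈ a′∈ a≢a′ x eq
  with ∈-applyUpTo⁻ (suc ∘ embed M) a∈ | ∈-applyUpTo⁻ (suc ∘ embed M) a′∈
... | i , i< , refl | j , j< , refl = a≢a′ (cong (suc ∘ embed M) (embed-separates-sqPlus5Cube M i< j< x
  (trans (sym ([+1+m]-[+1+n]≡[+m]-[+n] (embed M i) (embed M j))) eq)))

theorem1p2 : Σ ℕ λ k → 1 ≤ k × ((N : ℕ) → 1 ≤ N →
    Σ (List ℕ) λ A → Unique A × All (λ a → 1 ≤ a × a ≤ N) A
    × (∀ {a a′} → a ∈ A → a′ ∈ A → a ≢ a′ → (x : ℤ) → (+ a) ℤ.- (+ a′) ≢ sqPlus5Cube x)
    × AtLeastGammaPower k (length A) N)
theorem1p2 = 50 , s≤s z≤n , λ N 1≤N →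
  let M , 125^M≤N , N<125^[1+M] = power-bracket (s≤s (s≤s z≤n)) 1≤N
  in embedSet M ,
     embedSet-unique M ,
     All.map (map₂ (λ a≤125^M → ℕₚ.≤-trans a≤125^M 125^M≤N)) (embedSet-bounds M) ,
     embedSet-differencesAvoid M ,
     subst (λ n → AtLeastGammaPower 50 n N) (sym (length-applyUpTo (suc ∘ embed M) (50 ^ M)))
       (50^M-atLeastGammaPower M (ℕₚ.<⇒≤ N<125^[1+M]))
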